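{- For every real $\varepsilon$ with $0<\varepsilon<0.5$ and every $l\in\mathbb{N}$ there exists a constant $C=C(\varepsilon,l)$ such that for every $k\in\mathbb{N}$, $R^2_\varepsilon(M_{l,k})\le C\cdot R(k)$.
   Context: $R(k)$ is the classical two-color Ramsey number: the least $n$ such that every 2-edge-coloring of $K_n$ contains a monochromatic $K_k$. A 2-edge-coloring (colors red, blue) of $K_n$ is $\varepsilon$-balanced if each color class has at least $\varepsilon\binom n2$ edges. $M_{l,k}$ denotes the 2-edge-colored graph with vertex set $L\sqcup R$, $|L|=l$, $|R|=k$, where all pairs inside $R$ are red edges, all pairs in $L\times R$ are blue edges, and $L$ is an independent set (no edges inside $L$). A color-consistent copy of a 2-edge-colored graph $H$ in a 2-edge-colored $K_n$ is an injective map $\phi:V(H)\to V(K_n)$ and a permutation $\pi$ of the two colors such that every edge $uv$ of $H$ is mapped to an edge $\phi(u)\phi(v)$ of color $\pi(\text{color of }uv)$. $R^2_\varepsilon(H)$ is the smallest $N$ such that for all $n\ge N$ every $\varepsilon$-balanced 2-edge-coloring of $K_n$ contains a color-consistent copy of $H$ ($\infty$ if no such $N$ exists).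
   Formalization: The parameter ε ranges over the rationals with $0<\varepsilon<0.5$ rather than over all reals in that interval. -}

module Defs where

open import Data.Nat using (ℕ; _+_; _*_; _≤_; _<_)
open import Data.Nat.Combinatorics using (_C_)
open import Data.Bool using (Bool; true; false; not; _∧_)
open import Data.Fin using (Fin; _<?_)
open import Data.List using (List; length; filter; cartesianProduct; allFin)
open import Data.Product using (Σ; ∃-syntax; _×_; _,_; proj₁; proj₂)
open import Data.Sum using (_⊎_; inj₁; inj₂)
open import Function.Definitions using (Injective)
open import Relation.Binary.PropositionalEquality using (_≡_; _≢_)
open import Relation.Nullary.Decidable using (_×-dec_)
open import Data.Bool.Properties using () renaming (_≟_ to _≟B_)

-- A 2-edge-coloring of K_n: symmetric map on vertex pairs; true = red, false = blue.
-- (Diagonal values are irrelevant.)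
record Coloring (n : ℕ) : Set where
  field
    col  : Fin n → Fin n → Bool
    symm : ∀ i j → col i j ≡ col j i
open Coloring public

edgeCount : ∀ {n} → Coloring n → Bool → ℕ
edgeCount {n} c b =
  length (filter (λ ij → (proj₁ ij <? proj₂ ij) ×-dec (col c (proj₁ ij) (proj₂ ij) ≟B b))
                 (cartesianProduct (allFin n) (allFin n)))

-- ε-balanced with ε = p / q : each colour class has ≥ (p/q)·binom(n,2) edges
Balanced : ℕ → ℕ → ∀ {n} → Coloring n → Set
Balanced p q {n} c = ∀ b → p * (n C 2) ≤ q * edgeCount c b

HasMonoClique : ∀ {n} → ℕ → Coloring n → Set
HasMonoClique {n} k c =
  Σ (Fin k → Fin n) λ f → Injective _≡_ _≡_ f × ∃[ b ] (∀ (i j : Fin k) → i ≢ j → col c (f i) (f j) ≡ b)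

RamseyProp : ℕ → ℕ → Set
RamseyProp k m = (c : Coloring m) → HasMonoClique k c

IsRamseyNumber : ℕ → ℕ → Set
IsRamseyNumber k r = RamseyProp k r × (∀ m → RamseyProp k m → r ≤ m)

-- colour-consistent copy of M_{l,k}: L = Fin l (independent), R = Fin k.
-- The colour permutation π is encoded by a : the image colour of red;
-- then blue maps to not a.
HasCopyM : ∀ {n} → ℕ → ℕ → Coloring n → Set
HasCopyM {n} l k c =
  Σ (Fin l ⊎ Fin k → Fin n) λ φ → Injective _≡_ _≡_ φ × ∃[ a ]
    ( (∀ (i j : Fin k) → i ≢ j → col c (φ (inj₂ i)) (φ (inj₂ j)) ≡ a)
    × (∀ (u : Fin l) (v : Fin k) → col c (φ (inj₁ u)) (φ (inj₂ v)) ≡ not a))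

module Submission where

-- With K = 16q², call a vertex b-sparse when fewer than n/K edges of colour b meet it, and mixed
-- when it is sparse in neither colour. Balancedness forces at least n/K mixed vertices: otherwise
-- the degree sums show that the red-sparse and the blue-sparse vertices each number at least
-- 5n/(16q), whereas every pair between these two classes is an edge counted by one of their small
-- degrees, so K times the product of their sizes is at most n².
--
-- Every mixed vertex has at least n/K neighbours of each colour, so averaging over the vertices
-- finds, among any set of mixed vertices, a new centre joined in a prescribed colour to a 1/(2K)
-- fraction of the set. Doing this l times in blue and then l times in red leaves a core of at least
-- n/(K(2K)^(2l)) ≥ R(k) mixed vertices, hence a monochromatic K_k inside it, and one of the two
-- sets of l centres is joined to it entirely in the opposite colour.

open import Defs
open import Data.Nat using (ℕ; zero; suc; _+_; _*_; _^_; _≤_; _<_; z≤n; s≤s; z<s; _<ᵇ_; >-nonZero)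
open import Data.Nat.Properties hiding (_≟_; _<?_; suc-injective; <-irrefl)
open import Data.Nat.Combinatorics using (_C_; nC1≡n; nCk+nC[k+1]≡[n+1]C[k+1])
open import Data.Nat.Tactic.RingSolver using (solve-∀)
open import Data.Bool using (Bool; true; false; not; _∧_; _∨_; T)
open import Data.Bool.Properties using (T-∧) renaming (_≟_ to _≟ᵇ_)
open import Data.Empty using (⊥-elim)
open import Data.Fin using (Fin; zero; suc; _≟_; _<?_) renaming (_<_ to _<ᶠ_)
open import Data.Fin.Properties using (suc-injective; <-irrefl; ¬Fin0)
open import Data.List using (List; []; _∷_; _++_; map; length; filter; tabulate; cartesianProduct)
open import Data.List.Properties using (length-++; filter-++; map-tabulate)
open import Data.List.Membership.Propositional using (_∉_)
import Data.List.Membership.DecPropositional as DecMembership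
open import Data.List.Relation.Unary.Any using (here; there)
open import Data.Product using (∃-syntax; Σ; _×_; _,_; proj₁; proj₂)
open import Data.Sum using (_⊎_; inj₁; inj₂)
open import Function using (_∘_)
open import Function.Bundles using (Equivalence)
open import Function.Definitions using (Injective)
open import Relation.Nullary using (Dec; does; yes; no; ¬_)
open import Relation.Nullary.Decidable using (dec-true; dec-false)
open import Relation.Unary using (Pred; Decidable)
open import Relation.Binary.PropositionalEquality
open import Algebra.Properties.Semiring.Sum +-*-semiring
  using (sum; sum-syntax; sum-cong-≗; ∑-distrib-+; ∑-comm; *-distribˡ-sum; *-distribʳ-sum)

-- Finite sums and counting

sum-mono-≤ : ∀ {n} {f g : Fin n → ℕ} → (∀ i → f i ≤ g i) → sum f ≤ sum g
sum-mono-≤ {zero}  f≤g = z≤n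
sum-mono-≤ {suc n} f≤g = +-mono-≤ (f≤g zero) (sum-mono-≤ (f≤g ∘ suc))

sum-const : ∀ n c → ∑[ i < n ] c ≡ n * c
sum-const zero    c = refl
sum-const (suc n) c = cong (c +_) (sum-const n c)

sum-≤-* : ∀ {n c} {f : Fin n → ℕ} → (∀ i → f i ≤ c) → sum f ≤ n * c
sum-≤-* {n} {c} f≤c = ≤-trans (sum-mono-≤ f≤c) (≤-reflexive (sum-const n c))

sum*sum : ∀ {m n} (f : Fin m → ℕ) (g : Fin n → ℕ) → sum f * sum g ≡ ∑[ i < m ] ∑[ j < n ] (f i * g j)
sum*sum {m} {n} f g = trans (*-distribʳ-sum (sum g) f) (sum-cong-≗ (λ i → *-distribˡ-sum (f i) g))

sum≤n*term : ∀ {n} (f : Fin n → ℕ) → 0 < sum f → ∃[ i ] sum f ≤ n * f i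
sum≤n*term {suc n} f _ with sum (f ∘ suc) | sum≤n*term (f ∘ suc)
... | zero  | _  = zero , +-monoʳ-≤ (f zero) z≤n
... | suc _ | ih with ih (s≤s z≤n)
...   | i , ≤n*fi with f zero ≤? f (suc i)
...     | yes f₀≤fi = suc i , +-mono-≤ f₀≤fi ≤n*fi
...     | no  f₀≰fi = zero , +-monoʳ-≤ (f zero) (≤-trans ≤n*fi (*-monoʳ-≤ n (<⇒≤ (≰⇒> f₀≰fi))))

0<a≤m*b⇒0<b : ∀ {a m b} → 0 < a → a ≤ m * b → 0 < b
0<a≤m*b⇒0<b {m = m} {zero}  0<a a≤m*0 = ⊥-elim (<⇒≱ 0<a (≤-trans a≤m*0 (≤-reflexive (*-zeroʳ m))))
0<a≤m*b⇒0<b {b = suc b} _ _ = s≤s z≤n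

𝟙 : Bool → ℕ
𝟙 true  = 1
𝟙 false = 0

𝟙≤1 : ∀ b → 𝟙 b ≤ 1
𝟙≤1 true  = ≤-refl
𝟙≤1 false = z≤n

𝟙-∧ : ∀ a b → 𝟙 (a ∧ b) ≡ 𝟙 a * 𝟙 b
𝟙-∧ true  b = sym (+-identityʳ (𝟙 b))
𝟙-∧ false b = refl

𝟙-∨ : ∀ a b → 𝟙 (a ∨ b) ≤ 𝟙 a + 𝟙 b
𝟙-∨ true  b = s≤s z≤n
𝟙-∨ false b = ≤-refl

𝟙-∧-monoˡ : ∀ {a b} → (T a → T b) → ∀ e → 𝟙 (a ∧ e) ≤ 𝟙 (b ∧ e)
𝟙-∧-monoˡ {false}         _   e = z≤n
𝟙-∧-monoˡ {true}  {true}  _   e = ≤-refl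
𝟙-∧-monoˡ {true}  {false} a⇒b e = ⊥-elim (a⇒b _)

𝟙*-monoʳ-≤ : ∀ p {a b} → (T p → a ≤ b) → 𝟙 p * a ≤ 𝟙 p * b
𝟙*-monoʳ-≤ false _   = z≤n
𝟙*-monoʳ-≤ true  a≤b = +-monoˡ-≤ 0 (a≤b _)

T-does : ∀ {p} {P : Set p} (P? : Dec P) → T (does P?) → P
T-does (yes p) _ = p

T-∧-split : ∀ {a b} → T (a ∧ b) → T a × T b
T-∧-split = Equivalence.to T-∧

T-not : ∀ {a} → T (not a) → ¬ T a
T-not {false} _ ()

∣_∣ : ∀ {n} → (Fin n → Bool) → ℕ
∣_∣ {n} P = ∑[ i < n ] 𝟙 (P i)

_∩_ : ∀ {n} → (Fin n → Bool) → (Fin n → Bool) → Fin n → Bool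
(P ∩ Q) x = P x ∧ Q x

∣P∣≤n : ∀ {n} (P : Fin n → Bool) → ∣ P ∣ ≤ n
∣P∣≤n {n} P = ≤-trans (sum-≤-* (𝟙≤1 ∘ P)) (≤-reflexive (*-identityʳ n))

disjoint⇒∣∣+∣∣≤n : ∀ {n} (P Q : Fin n → Bool) → (∀ y → T (P y) → ¬ T (Q y)) → ∣ P ∣ + ∣ Q ∣ ≤ n
disjoint⇒∣∣+∣∣≤n {n} P Q disjoint = begin
  ∣ P ∣ + ∣ Q ∣                 ≡⟨ ∑-distrib-+ (𝟙 ∘ P) (𝟙 ∘ Q) ⟨
  ∑[ y < n ] (𝟙 (P y) + 𝟙 (Q y)) ≤⟨ sum-≤-* (λ y → pointwise (P y) (Q y) (disjoint y)) ⟩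
  n * 1                         ≡⟨ *-identityʳ n ⟩
  n                             ∎
  where
  open ≤-Reasoning
  pointwise : ∀ p q → (T p → ¬ T q) → 𝟙 p + 𝟙 q ≤ 1
  pointwise false q     _ = 𝟙≤1 q
  pointwise true  false _ = ≤-refl
  pointwise true  true  ¬q = ⊥-elim (¬q _ _)

∣P∣≤∣P∖F∣+∣F∣ : ∀ {n} (P F : Fin n → Bool) → ∣ P ∣ ≤ ∣ (not ∘ F) ∩ P ∣ + ∣ F ∣
∣P∣≤∣P∖F∣+∣F∣ {n} P F = ≤-trans (sum-mono-≤ (λ x → pointwise (F x) (P x)))
                                 (≤-reflexive (∑-distrib-+ (𝟙 ∘ ((not ∘ F) ∩ P)) (𝟙 ∘ F)))
  where
  pointwise : ∀ f p → 𝟙 p ≤ 𝟙 (not f ∧ p) + 𝟙 f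
  pointwise true  p = ≤-trans (𝟙≤1 p) (m≤n+m 1 (𝟙 (false ∧ p)))
  pointwise false p = m≤m+n (𝟙 p) 0

∑𝟙*∣∩∣-swap : ∀ {n} (A B : Fin n → Bool) (N : Fin n → Fin n → Bool) → (∀ x y → N x y ≡ N y x) →
  ∑[ y < n ] (𝟙 (B y) * ∣ A ∩ N y ∣) ≡ ∑[ x < n ] (𝟙 (A x) * ∣ B ∩ N x ∣)
∑𝟙*∣∩∣-swap {n} A B N N-sym = begin
  ∑[ y < n ] (𝟙 (B y) * ∣ A ∩ N y ∣)
    ≡⟨ sum-cong-≗ (λ y → *-distribˡ-sum (𝟙 (B y)) (𝟙 ∘ (A ∩ N y))) ⟩
  ∑[ y < n ] ∑[ x < n ] (𝟙 (B y) * 𝟙 (A x ∧ N y x))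
    ≡⟨ sum-cong-≗ (λ y → sum-cong-≗ (λ x → pointwise (B y) (A x) (N-sym y x))) ⟩
  ∑[ y < n ] ∑[ x < n ] (𝟙 (A x) * 𝟙 (B y ∧ N x y))
    ≡⟨ ∑-comm (λ y x → 𝟙 (A x) * 𝟙 (B y ∧ N x y)) ⟩
  ∑[ x < n ] ∑[ y < n ] (𝟙 (A x) * 𝟙 (B y ∧ N x y))
    ≡⟨ sum-cong-≗ (λ x → *-distribˡ-sum (𝟙 (A x)) (𝟙 ∘ (B ∩ N x))) ⟨
  ∑[ x < n ] (𝟙 (A x) * ∣ B ∩ N x ∣) ∎
  where
  open ≡-Reasoning
  pointwise : ∀ b a {e f} → e ≡ f → 𝟙 b * 𝟙 (a ∧ e) ≡ 𝟙 a * 𝟙 (b ∧ f)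
  pointwise b a {e} refl = begin
    𝟙 b * 𝟙 (a ∧ e)     ≡⟨ cong (𝟙 b *_) (𝟙-∧ a e) ⟩
    𝟙 b * (𝟙 a * 𝟙 e)   ≡⟨ x*[y*z]≡y*[x*z] (𝟙 b) (𝟙 a) (𝟙 e) ⟩
    𝟙 a * (𝟙 b * 𝟙 e)   ≡⟨ cong (𝟙 a *_) (𝟙-∧ b e) ⟨
    𝟙 a * 𝟙 (b ∧ e)     ∎
    where
    x*[y*z]≡y*[x*z] : ∀ x y z → x * (y * z) ≡ y * (x * z)
    x*[y*z]≡y*[x*z] = solve-∀

∣∣-injection : ∀ {n r} (P : Fin n → Bool) → r ≤ ∣ P ∣ →
  Σ (Fin r → Fin n) λ f → Injective _≡_ _≡_ f × (∀ i → T (P (f i)))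
∣∣-injection {zero}  {zero} P _ = (λ ()) , (λ {}) , (λ ())
∣∣-injection {suc n} {r}    P r≤∣P∣ = split (P zero) refl r≤∣P∣
  where
  split : ∀ {r} b → P zero ≡ b → r ≤ 𝟙 b + ∣ P ∘ suc ∣ →
    Σ (Fin r → Fin (suc n)) λ f → Injective _≡_ _≡_ f × (∀ i → T (P (f i)))
  split false _ r≤ with ∣∣-injection (P ∘ suc) r≤
  ... | f , f-inj , f∈P = suc ∘ f , f-inj ∘ suc-injective , f∈P
  split {zero}  true _ _ = (λ ()) , (λ {}) , (λ ())
  split {suc r} true P₀ (s≤s r≤) with ∣∣-injection (P ∘ suc) r≤
  ... | f , f-inj , f∈P = g , g-inj , g∈P
    where
    g : Fin (suc r) → Fin (suc n)
    g zero    = zero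
    g (suc i) = suc (f i)
    g-inj : Injective _≡_ _≡_ g
    g-inj {zero}  {zero}  _ = refl
    g-inj {suc i} {suc j} e = cong suc (f-inj (suc-injective e))
    g∈P : ∀ i → T (P (g i))
    g∈P zero    rewrite P₀ = _
    g∈P (suc i) = f∈P i

∣≟∣≡1 : ∀ {n} (y : Fin n) → ∣ (λ x → does (x ≟ y)) ∣ ≡ 1
∣≟∣≡1 {suc n} zero    = cong suc (trans (sum-const n 0) (*-zeroʳ n))
∣≟∣≡1         (suc y) = ∣≟∣≡1 y

_∈ᵇ_ : ∀ {n} → Fin n → List (Fin n) → Bool
x ∈ᵇ F = does (DecMembership._∈?_ _≟_ x F)

∣∈ᵇ∣≤length : ∀ {n} (F : List (Fin n)) → ∣ (_∈ᵇ F) ∣ ≤ length F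
∣∈ᵇ∣≤length {n} [] = ≤-reflexive (trans (sum-const n 0) (*-zeroʳ n))
∣∈ᵇ∣≤length {n} (y ∷ F) = begin
  ∑[ x < n ] 𝟙 (does (x ≟ y) ∨ x ∈ᵇ F)            ≤⟨ sum-mono-≤ (λ x → 𝟙-∨ (does (x ≟ y)) (x ∈ᵇ F)) ⟩
  ∑[ x < n ] (𝟙 (does (x ≟ y)) + 𝟙 (x ∈ᵇ F))      ≡⟨ ∑-distrib-+ (λ x → 𝟙 (does (x ≟ y))) (𝟙 ∘ (_∈ᵇ F)) ⟩
  ∣ (λ x → does (x ≟ y)) ∣ + ∣ (_∈ᵇ F) ∣           ≤⟨ +-mono-≤ (≤-reflexive (∣≟∣≡1 y)) (∣∈ᵇ∣≤length F) ⟩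
  suc (length F)                                  ∎
  where open ≤-Reasoning

length-filter-tabulate : ∀ {a p} {A : Set a} {P : Pred A p} (P? : Decidable P) {n} (f : Fin n → A) →
  length (filter P? (tabulate f)) ≡ ∑[ i < n ] 𝟙 (does (P? (f i)))
length-filter-tabulate P? {zero}  f = refl
length-filter-tabulate P? {suc n} f with does (P? (f zero))
... | true  = cong suc (length-filter-tabulate P? (f ∘ suc))
... | false = length-filter-tabulate P? (f ∘ suc)

length-filter-cartesianProduct : ∀ {a b p} {A : Set a} {B : Set b} {P : Pred (A × B) p}
  (P? : Decidable P) {n m} (f : Fin n → A) (g : Fin m → B) →
  length (filter P? (cartesianProduct (tabulate f) (tabulate g))) ≡
    ∑[ i < n ] ∑[ j < m ] 𝟙 (does (P? (f i , g j)))
length-filter-cartesianProduct P? {zero}      f g = refl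
length-filter-cartesianProduct P? {suc n} {m} f g = begin
  length (filter P? (row ++ rest))
    ≡⟨ cong length (filter-++ P? row rest) ⟩
  length (filter P? row ++ filter P? rest)
    ≡⟨ length-++ (filter P? row) ⟩
  length (filter P? row) + length (filter P? rest)
    ≡⟨ cong₂ _+_ (cong (length ∘ filter P?) (map-tabulate g (f zero ,_)))
                 (length-filter-cartesianProduct P? (f ∘ suc) g) ⟩
  length (filter P? (tabulate ((f zero ,_) ∘ g))) + ∑[ i < n ] ∑[ j < m ] 𝟙 (does (P? (f (suc i) , g j)))
    ≡⟨ cong (_+ _) (length-filter-tabulate P? ((f zero ,_) ∘ g)) ⟩
  ∑[ j < m ] 𝟙 (does (P? (f zero , g j))) + ∑[ i < n ] ∑[ j < m ] 𝟙 (does (P? (f (suc i) , g j))) ∎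
  where
  open ≡-Reasoning
  row  = map (f zero ,_) (tabulate g)
  rest = cartesianProduct (tabulate (f ∘ suc)) (tabulate g)

neighbours : ∀ {n} → Coloring n → Bool → Fin n → Fin n → Bool
neighbours c b y x = not (does (y ≟ x)) ∧ does (col c y x ≟ᵇ b)

deg : ∀ {n} → Coloring n → Bool → Fin n → ℕ
deg c b y = ∣ neighbours c b y ∣

deg≤n : ∀ {n} (c : Coloring n) b y → deg c b y ≤ n
deg≤n c b y = ∣P∣≤n (neighbours c b y)

neighbours-sym : ∀ {n} (c : Coloring n) b x y → neighbours c b x y ≡ neighbours c b y x
neighbours-sym c b x y = cong₂ (λ e f → not e ∧ does (f ≟ᵇ b)) ≟-sym (symm c x y)
  where
  ≟-sym : does (x ≟ y) ≡ does (y ≟ x)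
  ≟-sym with x ≟ y
  ... | yes x≡y = sym (dec-true (y ≟ x) (sym x≡y))
  ... | no  x≢y = sym (dec-false (y ≟ x) (x≢y ∘ sym))

neighbours-sound : ∀ {n} (c : Coloring n) b y x → T (neighbours c b y x) → y ≢ x × col c y x ≡ b
neighbours-sound c b y x ∈N with y ≟ x | col c y x ≟ᵇ b
... | no y≢x | yes ≡b = y≢x , ≡b

neighbours-complete : ∀ {n} (c : Coloring n) {b y x} → y ≢ x → col c y x ≡ b → T (neighbours c b y x)
neighbours-complete c {b} {y} {x} y≢x refl
  rewrite dec-false (y ≟ x) y≢x | dec-true (col c y x ≟ᵇ col c y x) refl = _

edgeCount≤∑deg : ∀ {n} (c : Coloring n) b → edgeCount c b ≤ ∑[ y < n ] deg c b y
edgeCount≤∑deg {n} c b = begin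
  edgeCount c b
    ≡⟨ length-filter-cartesianProduct _ {n} {n} (λ i → i) (λ j → j) ⟩
  ∑[ i < n ] ∑[ j < n ] 𝟙 (does (i <? j) ∧ does (col c i j ≟ᵇ b))
    ≤⟨ sum-mono-≤ (λ i → sum-mono-≤ (λ j → ordered⇒neighbours i j)) ⟩
  ∑[ i < n ] deg c b i ∎
  where
  open ≤-Reasoning
  ordered⇒neighbours : ∀ i j → 𝟙 (does (i <? j) ∧ does (col c i j ≟ᵇ b)) ≤ 𝟙 (neighbours c b i j)
  ordered⇒neighbours i j = 𝟙-∧-monoˡ (distinct ∘ T-does (i <? j)) (does (col c i j ≟ᵇ b))
    where
    distinct : i <ᶠ j → T (not (does (i ≟ j)))
    distinct i<j rewrite dec-false (i ≟ j) (λ { refl → <-irrefl refl i<j }) = _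

2*nC2+n≡n*n : ∀ n → 2 * (n C 2) + n ≡ n * n
2*nC2+n≡n*n zero    = refl
2*nC2+n≡n*n (suc n) = begin
  2 * (suc n C 2) + suc n   ≡⟨ cong (λ t → 2 * t + suc n) (sym (nCk+nC[k+1]≡[n+1]C[k+1] n 1)) ⟩
  2 * (n C 1 + n C 2) + suc n ≡⟨ cong (λ t → 2 * (t + n C 2) + suc n) (nC1≡n n) ⟩
  2 * (n + n C 2) + suc n   ≡⟨ regroup n (n C 2) ⟩
  (2 * (n C 2) + n) + (2 * n + 1) ≡⟨ cong (_+ (2 * n + 1)) (2*nC2+n≡n*n n) ⟩
  n * n + (2 * n + 1)       ≡⟨ square-suc n ⟩
  suc n * suc n             ∎
  where
  open ≡-Reasoning
  regroup : ∀ n x → 2 * (n + x) + suc n ≡ (2 * x + n) + (2 * n + 1)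
  regroup = solve-∀
  square-suc : ∀ n → n * n + (2 * n + 1) ≡ suc n * suc n
  square-suc = solve-∀

balanced⇒∑deg : ∀ p q {n} (c : Coloring n) → 0 < p → Balanced p q c → ∀ b →
  n * n ≤ 2 * (q * ∑[ y < n ] deg c b y) + n
balanced⇒∑deg p q {n} c p>0 balanced b = begin
  n * n                              ≡⟨ sym (2*nC2+n≡n*n n) ⟩
  2 * (n C 2) + n                    ≤⟨ +-monoˡ-≤ n (*-monoʳ-≤ 2 nC2≤q*edges) ⟩
  2 * (q * edgeCount c b) + n        ≤⟨ +-monoˡ-≤ n (*-monoʳ-≤ 2 (*-monoʳ-≤ q (edgeCount≤∑deg c b))) ⟩
  2 * (q * ∑[ y < n ] deg c b y) + n ∎
  where
  open ≤-Reasoning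
  nC2≤q*edges : n C 2 ≤ q * edgeCount c b
  nC2≤q*edges = ≤-trans (m≤n*m (n C 2) p {{>-nonZero p>0}}) (balanced b)

-- Sparse and mixed vertices

sparse : ∀ {n} → Coloring n → ℕ → Bool → Fin n → Bool
sparse {n} c K b y = K * deg c b y <ᵇ n

-- The three classes partition the vertices: blueSparse excludes the red-sparse ones.
redSparse blueSparse mixed : ∀ {n} → Coloring n → ℕ → Fin n → Bool
redSparse  c K y = sparse c K true y
blueSparse c K y = not (sparse c K true y) ∧ sparse c K false y
mixed      c K y = not (sparse c K true y) ∧ not (sparse c K false y)

classify : ∀ {n} (c : Coloring n) K y →
  T (redSparse c K y) ⊎ T (blueSparse c K y) ⊎ T (mixed c K y)
classify c K y with sparse c K true y | sparse c K false y
... | true  | _     = inj₁ _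
... | false | true  = inj₂ (inj₁ _)
... | false | false = inj₂ (inj₂ _)

sparse⇒deg< : ∀ {n} (c : Coloring n) K b y → T (sparse c K b y) → K * deg c b y < n
sparse⇒deg< {n} c K b y = <ᵇ⇒< (K * deg c b y) n

blueSparse⇒deg< : ∀ {n} (c : Coloring n) K y → T (blueSparse c K y) → K * deg c false y < n
blueSparse⇒deg< c K y = sparse⇒deg< c K false y ∘ proj₂ ∘ T-∧-split

¬sparse⇒n≤deg : ∀ {n} (c : Coloring n) K b y → ¬ T (sparse c K b y) → n ≤ K * deg c b y
¬sparse⇒n≤deg c K b y ¬s = ≮⇒≥ (¬s ∘ <⇒<ᵇ)

mixed⇒n≤deg : ∀ {n} (c : Coloring n) K y → T (mixed c K y) → ∀ b → n ≤ K * deg c b y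
mixed⇒n≤deg c K y m true  = ¬sparse⇒n≤deg c K true  y (T-not (proj₁ (T-∧-split m)))
mixed⇒n≤deg c K y m false = ¬sparse⇒n≤deg c K false y (T-not (proj₂ (T-∧-split m)))

≤-by-cases : ∀ {d m M} p q r → T p ⊎ T q ⊎ T r → (T p → d ≤ m) → d ≤ M →
  d ≤ m * 𝟙 p + M * (𝟙 q + 𝟙 r)
≤-by-cases {m = m}     true  _     _    _ d≤m _   = ≤-trans (d≤m _) (≤-trans (m≤m*n m 1) (m≤m+n _ _))
≤-by-cases {m = m} {M} false true  r    _ _   d≤M = ≤-trans d≤M (≤-trans (m≤m*n M (suc (𝟙 r))) (m≤n+m _ (m * 0)))
≤-by-cases {m = m} {M} false false true _ _   d≤M = ≤-trans d≤M (≤-trans (m≤m*n M 1) (m≤n+m _ (m * 0)))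
≤-by-cases             false false false (inj₂ (inj₂ ())) _ _

∑deg-bound : ∀ {n} (c : Coloring n) K b (P Q R : Fin n → Bool) →
  (∀ y → T (P y) ⊎ T (Q y) ⊎ T (R y)) → (∀ y → T (P y) → K * deg c b y < n) →
  K * ∑[ y < n ] deg c b y ≤ n * ∣ P ∣ + K * n * (∣ Q ∣ + ∣ R ∣)
∑deg-bound {n} c K b P Q R cover P-sparse = begin
  K * ∑[ y < n ] deg c b y
    ≡⟨ *-distribˡ-sum K (deg c b) ⟩
  ∑[ y < n ] (K * deg c b y)
    ≤⟨ sum-mono-≤ (λ y → ≤-by-cases (P y) (Q y) (R y) (cover y) (<⇒≤ ∘ P-sparse y) (*-monoʳ-≤ K (deg≤n c b y))) ⟩
  ∑[ y < n ] (n * 𝟙 (P y) + K * n * (𝟙 (Q y) + 𝟙 (R y)))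
    ≡⟨ ∑-distrib-+ (λ y → n * 𝟙 (P y)) (λ y → K * n * (𝟙 (Q y) + 𝟙 (R y))) ⟩
  ∑[ y < n ] (n * 𝟙 (P y)) + ∑[ y < n ] (K * n * (𝟙 (Q y) + 𝟙 (R y)))
    ≡⟨ cong₂ _+_ (sym (*-distribˡ-sum n (𝟙 ∘ P))) (sym (*-distribˡ-sum (K * n) (λ y → 𝟙 (Q y) + 𝟙 (R y)))) ⟩
  n * ∣ P ∣ + K * n * ∑[ y < n ] (𝟙 (Q y) + 𝟙 (R y))
    ≡⟨ cong (λ t → n * ∣ P ∣ + K * n * t) (∑-distrib-+ (𝟙 ∘ Q) (𝟙 ∘ R)) ⟩
  n * ∣ P ∣ + K * n * (∣ Q ∣ + ∣ R ∣) ∎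
  where open ≤-Reasoning

𝟙*𝟙-cover : ∀ p q a b → (T p → T q → T a ⊎ T b) → 𝟙 p * 𝟙 q ≤ 𝟙 p * 𝟙 a + 𝟙 q * 𝟙 b
𝟙*𝟙-cover false q     a b _ = z≤n
𝟙*𝟙-cover true  false a b _ = z≤n
𝟙*𝟙-cover true  true  true  b _ = s≤s z≤n
𝟙*𝟙-cover true  true  false true  _ = s≤s z≤n
𝟙*𝟙-cover true  true  false false a⊎b with a⊎b _ _
... | inj₁ ()
... | inj₂ ()

∑𝟙*deg-bound : ∀ {n} (c : Coloring n) K b (P : Fin n → Bool) → (∀ y → T (P y) → K * deg c b y < n) →
  K * ∑[ y < n ] (𝟙 (P y) * deg c b y) ≤ n * ∣ P ∣
∑𝟙*deg-bound {n} c K b P P-sparse = begin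
  K * ∑[ y < n ] (𝟙 (P y) * deg c b y) ≡⟨ *-distribˡ-sum K (λ y → 𝟙 (P y) * deg c b y) ⟩
  ∑[ y < n ] (K * (𝟙 (P y) * deg c b y)) ≤⟨ sum-mono-≤ (λ y → pointwise (P y) (P-sparse y)) ⟩
  ∑[ y < n ] (n * 𝟙 (P y))             ≡⟨ *-distribˡ-sum n (𝟙 ∘ P) ⟨
  n * ∣ P ∣                            ∎
  where
  open ≤-Reasoning
  pointwise : ∀ {d} p → (T p → K * d < n) → K * (𝟙 p * d) ≤ n * 𝟙 p
  pointwise         false _   = ≤-reflexive (trans (*-zeroʳ K) (sym (*-zeroʳ n)))
  pointwise {d} true  Kd<n = begin
    K * (d + 0) ≡⟨ cong (K *_) (+-identityʳ d) ⟩
    K * d       ≤⟨ <⇒≤ (Kd<n _) ⟩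
    n           ≡⟨ *-identityʳ n ⟨
    n * 1       ∎

∣∣*∣∣≤∑𝟙*deg : ∀ {n} (c : Coloring n) (P Q : Fin n → Bool) → (∀ y → T (P y) → ¬ T (Q y)) →
  ∣ P ∣ * ∣ Q ∣ ≤ ∑[ x < n ] (𝟙 (P x) * deg c true x) + ∑[ y < n ] (𝟙 (Q y) * deg c false y)
∣∣*∣∣≤∑𝟙*deg {n} c P Q disjoint = begin
  ∣ P ∣ * ∣ Q ∣
    ≡⟨ sum*sum (𝟙 ∘ P) (𝟙 ∘ Q) ⟩
  ∑[ x < n ] ∑[ y < n ] (𝟙 (P x) * 𝟙 (Q y))
    ≤⟨ sum-mono-≤ (λ x → sum-mono-≤ (λ y → 𝟙*𝟙-cover (P x) (Q y) _ _ (red-or-blue x y))) ⟩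
  ∑[ x < n ] ∑[ y < n ] (red x y + blue x y)
    ≡⟨ sum-cong-≗ (λ x → ∑-distrib-+ (red x) (λ y → blue x y)) ⟩
  ∑[ x < n ] (∑[ y < n ] red x y + ∑[ y < n ] blue x y)
    ≡⟨ ∑-distrib-+ (λ x → ∑[ y < n ] red x y) (λ x → ∑[ y < n ] blue x y) ⟩
  ∑[ x < n ] ∑[ y < n ] red x y + ∑[ x < n ] ∑[ y < n ] blue x y
    ≡⟨ cong₂ _+_ (sum-cong-≗ (λ x → *-distribˡ-sum (𝟙 (P x)) (neighbourCount true x)))
                 (trans (sum-cong-≗ (λ y → *-distribˡ-sum (𝟙 (Q y)) (neighbourCount false y))) (sym (∑-comm blue))) ⟨
  ∑[ x < n ] (𝟙 (P x) * deg c true x) + ∑[ y < n ] (𝟙 (Q y) * deg c false y) ∎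
  where
  open ≤-Reasoning
  neighbourCount : Bool → Fin n → Fin n → ℕ
  neighbourCount b y x = 𝟙 (neighbours c b y x)
  red blue : Fin n → Fin n → ℕ
  red  x y = 𝟙 (P x) * neighbourCount true x y
  blue x y = 𝟙 (Q y) * neighbourCount false y x
  red-or-blue : ∀ x y → T (P x) → T (Q y) → T (neighbours c true x y) ⊎ T (neighbours c false y x)
  red-or-blue x y px qy = by-colour (col c x y) refl
    where
    x≢y : x ≢ y
    x≢y refl = disjoint x px qy
    by-colour : ∀ a → col c x y ≡ a → T (neighbours c true x y) ⊎ T (neighbours c false y x)
    by-colour true  xy = inj₁ (neighbours-complete c x≢y xy)
    by-colour false xy = inj₂ (neighbours-complete c (x≢y ∘ sym) (trans (symm c y x) xy))

sparse-product-bound : ∀ {n} (c : Coloring n) K (P Q : Fin n → Bool) →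
  (∀ y → T (P y) → K * deg c true y < n) → (∀ y → T (Q y) → K * deg c false y < n) →
  (∀ y → T (P y) → ¬ T (Q y)) → K * (∣ P ∣ * ∣ Q ∣) ≤ n * (∣ P ∣ + ∣ Q ∣)
sparse-product-bound {n} c K P Q P-sparse Q-sparse disjoint = begin
  K * (∣ P ∣ * ∣ Q ∣)  ≤⟨ *-monoʳ-≤ K (∣∣*∣∣≤∑𝟙*deg c P Q disjoint) ⟩
  K * (∑[ x < n ] (𝟙 (P x) * deg c true x) + ∑[ y < n ] (𝟙 (Q y) * deg c false y))
                       ≡⟨ *-distribˡ-+ K _ _ ⟩
  K * ∑[ x < n ] (𝟙 (P x) * deg c true x) + K * ∑[ y < n ] (𝟙 (Q y) * deg c false y)
                       ≤⟨ +-mono-≤ (∑𝟙*deg-bound c K true P P-sparse) (∑𝟙*deg-bound c K false Q Q-sparse) ⟩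
  n * ∣ P ∣ + n * ∣ Q ∣ ≡⟨ *-distribˡ-+ n ∣ P ∣ ∣ Q ∣ ⟨
  n * (∣ P ∣ + ∣ Q ∣)   ∎
  where open ≤-Reasoning

Kn≤-from-degree-bounds : ∀ {n q K S b t} → 0 < n → n * n ≤ 2 * (q * S) + n → K * S ≤ n * b + K * n * t →
  K * n ≤ 2 * q * b + 2 * q * K * t + K
Kn≤-from-degree-bounds {n} {q} {K} {S} {b} {t} n>0 n²≤ KS≤ = *-cancelˡ-≤ n {{>-nonZero n>0}} (begin
  n * (K * n)                          ≡⟨ lhs n K ⟩
  K * (n * n)                          ≤⟨ *-monoʳ-≤ K n²≤ ⟩
  K * (2 * (q * S) + n)                ≡⟨ middle K q S n ⟩
  2 * q * (K * S) + n * K              ≤⟨ +-monoˡ-≤ (n * K) (*-monoʳ-≤ (2 * q) KS≤) ⟩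
  2 * q * (n * b + K * n * t) + n * K  ≡⟨ rhs q n b K t ⟩
  n * (2 * q * b + 2 * q * K * t + K)  ∎)
  where
  open ≤-Reasoning
  lhs : ∀ n K → n * (K * n) ≡ K * (n * n)
  lhs = solve-∀
  middle : ∀ K q S n → K * (2 * (q * S) + n) ≡ 2 * q * (K * S) + n * K
  middle = solve-∀
  rhs : ∀ q n b K t → 2 * q * (n * b + K * n * t) + n * K ≡ n * (2 * q * b + 2 * q * K * t + K)
  rhs = solve-∀

4qn+16q²≤6q²n : ∀ {q n} → 1 ≤ q → 8 ≤ n → 4 * q * n + 16 * (q * q) ≤ 6 * (q * q) * n
4qn+16q²≤6q²n {q} {n} q≥1 n≥8 = begin
  4 * q * n + 16 * (q * q)          ≤⟨ +-monoˡ-≤ _ (*-monoˡ-≤ n (*-monoʳ-≤ 4 (m≤m*n q q {{>-nonZero q≥1}}))) ⟩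
  4 * (q * q) * n + 16 * (q * q)    ≡⟨ cong (4 * (q * q) * n +_) (times8 q) ⟩
  4 * (q * q) * n + 2 * (q * q) * 8 ≤⟨ +-monoʳ-≤ (4 * (q * q) * n) (*-monoʳ-≤ (2 * (q * q)) n≥8) ⟩
  4 * (q * q) * n + 2 * (q * q) * n ≡⟨ six q n ⟩
  6 * (q * q) * n                   ∎
  where
  open ≤-Reasoning
  times8 : ∀ q → 16 * (q * q) ≡ 2 * (q * q) * 8
  times8 = solve-∀
  six : ∀ q n → 4 * (q * q) * n + 2 * (q * q) * n ≡ 6 * (q * q) * n
  six = solve-∀

-- With K = 16q² the slack 2qb + 2qKm + K is at most 4qn + 16q² ≤ 6q²n, which leaves 10q²n ≤ 2qKρ.
5qn≤Kρ : ∀ {q n b ρ m} → 1 ≤ q → 8 ≤ n → b ≤ n → 16 * (q * q) * m ≤ n →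
  16 * (q * q) * n ≤ 2 * q * b + 2 * q * (16 * (q * q)) * (ρ + m) + 16 * (q * q) →
  5 * q * n ≤ 16 * (q * q) * ρ
5qn≤Kρ {q} {n} {b} {ρ} {m} q≥1 n≥8 b≤n Km≤n Kn≤ =
  *-cancelˡ-≤ (2 * q) {{>-nonZero (≤-trans q≥1 (m≤n*m q 2))}} (+-cancelʳ-≤ slack _ _ (begin
  2 * q * (5 * q * n) + slack     ≡⟨ ten q n ⟩
  10 * (q * q) * n + slack        ≤⟨ +-monoʳ-≤ (10 * (q * q) * n) (4qn+16q²≤6q²n q≥1 n≥8) ⟩
  10 * (q * q) * n + 6 * (q * q) * n ≡⟨ sixteen q n ⟩
  K * n                           ≤⟨ Kn≤ ⟩
  2 * q * b + 2 * q * K * (ρ + m) + K ≡⟨ regroup q b K ρ m ⟩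
  2 * q * (K * ρ) + (2 * q * b + 2 * q * (K * m) + K)
                                  ≤⟨ +-monoʳ-≤ (2 * q * (K * ρ)) (+-monoˡ-≤ K (+-mono-≤ (*-monoʳ-≤ (2 * q) b≤n) (*-monoʳ-≤ (2 * q) Km≤n))) ⟩
  2 * q * (K * ρ) + (2 * q * n + 2 * q * n + K) ≡⟨ cong (2 * q * (K * ρ) +_) (four q n) ⟩
  2 * q * (K * ρ) + slack         ∎))
  where
  open ≤-Reasoning
  K = 16 * (q * q)
  slack = 4 * q * n + 16 * (q * q)
  ten : ∀ q n → 2 * q * (5 * q * n) + (4 * q * n + 16 * (q * q)) ≡ 10 * (q * q) * n + (4 * q * n + 16 * (q * q))
  ten = solve-∀
  sixteen : ∀ q n → 10 * (q * q) * n + 6 * (q * q) * n ≡ 16 * (q * q) * n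
  sixteen = solve-∀
  regroup : ∀ q b K ρ m → 2 * q * b + 2 * q * K * (ρ + m) + K ≡ 2 * q * (K * ρ) + (2 * q * b + 2 * q * (K * m) + K)
  regroup = solve-∀
  four : ∀ q n → 2 * q * n + 2 * q * n + 16 * (q * q) ≡ 4 * q * n + 16 * (q * q)
  four = solve-∀

n²<Kβρ : ∀ {q n β ρ} → 1 ≤ q → 1 ≤ n → 5 * q * n ≤ 16 * (q * q) * β → 5 * q * n ≤ 16 * (q * q) * ρ →
  n * n < 16 * (q * q) * (β * ρ)
n²<Kβρ {q} {n} {β} {ρ} q≥1 n≥1 β≥ ρ≥ = *-cancelˡ-< K (n * n) (K * (β * ρ)) (begin-strict
  K * (n * n)                 ≡⟨ sixteen q n ⟩
  16 * (q * n * (q * n))      <⟨ *-monoˡ-< (q * n * (q * n)) {{>-nonZero qn²>0}} (m<m+n 16 {9} z<s) ⟩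
  25 * (q * n * (q * n))      ≡⟨ square q n ⟩
  (5 * q * n) * (5 * q * n)   ≤⟨ *-mono-≤ β≥ ρ≥ ⟩
  (K * β) * (K * ρ)           ≡⟨ regroup K β ρ ⟩
  K * (K * (β * ρ))           ∎)
  where
  open ≤-Reasoning
  K = 16 * (q * q)
  qn²>0 : 0 < q * n * (q * n)
  qn²>0 = let qn>0 = *-mono-≤ q≥1 n≥1 in *-mono-≤ qn>0 qn>0
  sixteen : ∀ q n → 16 * (q * q) * (n * n) ≡ 16 * (q * n * (q * n))
  sixteen = solve-∀
  square : ∀ q n → 25 * (q * n * (q * n)) ≡ (5 * q * n) * (5 * q * n)
  square = solve-∀
  regroup : ∀ K β ρ → (K * β) * (K * ρ) ≡ K * (K * (β * ρ))
  regroup = solve-∀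

many-mixed : ∀ p q {n} (c : Coloring n) → 0 < p → 1 ≤ q → 8 ≤ n → Balanced p q c →
  n ≤ 16 * (q * q) * ∣ mixed c (16 * (q * q)) ∣
many-mixed p q {n} c p>0 q≥1 n≥8 balanced = ≮⇒≥ λ KM<n →
  <⇒≱ (n²<Kβρ q≥1 (≤-trans (s≤s z≤n) n≥8) (red-large KM<n) (blue-large KM<n)) (begin
    K * (∣ red ∣ * ∣ blue ∣) ≤⟨ sparse-product-bound c K red blue red-sparse blue-sparse disjoint ⟩
    n * (∣ red ∣ + ∣ blue ∣) ≤⟨ *-monoʳ-≤ n (disjoint⇒∣∣+∣∣≤n red blue disjoint) ⟩
    n * n                   ∎)
  where
  open ≤-Reasoning
  K = 16 * (q * q)
  red blue : Fin n → Bool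
  red  = redSparse c K
  blue = blueSparse c K
  red-sparse : ∀ y → T (red y) → K * deg c true y < n
  red-sparse = sparse⇒deg< c K true
  blue-sparse : ∀ y → T (blue y) → K * deg c false y < n
  blue-sparse = blueSparse⇒deg< c K
  disjoint : ∀ y → T (red y) → ¬ T (blue y)
  disjoint y r b = T-not (proj₁ (T-∧-split b)) r
  class-large : ∀ {b} (P Q : Fin n → Bool) → K * ∣ mixed c K ∣ < n →
    K * ∑[ y < n ] deg c b y ≤ n * ∣ P ∣ + K * n * (∣ Q ∣ + ∣ mixed c K ∣) → 5 * q * n ≤ K * ∣ Q ∣
  class-large {b} P Q KM<n ∑deg≤ = 5qn≤Kρ q≥1 n≥8 (∣P∣≤n P) (<⇒≤ KM<n)
    (Kn≤-from-degree-bounds {q = q} {K = K} (≤-trans (s≤s z≤n) n≥8) (balanced⇒∑deg p q c p>0 balanced b) ∑deg≤)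
  blue-large : K * ∣ mixed c K ∣ < n → 5 * q * n ≤ K * ∣ blue ∣
  blue-large KM<n = class-large red blue KM<n
    (∑deg-bound c K true red blue (mixed c K) (classify c K) red-sparse)
  red-large : K * ∣ mixed c K ∣ < n → 5 * q * n ≤ K * ∣ red ∣
  red-large KM<n = class-large blue red KM<n
    (∑deg-bound c K false blue red (mixed c K) reorder blue-sparse)
    where
    reorder : ∀ y → T (blue y) ⊎ T (red y) ⊎ T (mixed c K y)
    reorder y with classify c K y
    ... | inj₁ r        = inj₂ (inj₁ r)
    ... | inj₂ (inj₁ b) = inj₁ b
    ... | inj₂ (inj₂ m) = inj₂ (inj₂ m)

-- Greedy common neighbourhoods

many-neighbours-outside : ∀ {n} (c : Coloring n) K b y (F : List (Fin n)) →
  n ≤ K * deg c b y → 2 * K * length F ≤ n → n ≤ 2 * K * ∣ (not ∘ (_∈ᵇ F)) ∩ neighbours c b y ∣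
many-neighbours-outside {n} c K b y F n≤Kdeg 2K∣F∣≤n = +-cancelʳ-≤ n n _ (begin
  n + n                                    ≡⟨ cong (n +_) (+-identityʳ n) ⟨
  2 * n                                    ≤⟨ *-monoʳ-≤ 2 n≤Kdeg ⟩
  2 * (K * deg c b y)                      ≤⟨ *-monoʳ-≤ 2 (*-monoʳ-≤ K deg≤) ⟩
  2 * (K * (∣ N∖F ∣ + length F))           ≡⟨ expand K ∣ N∖F ∣ (length F) ⟩
  2 * K * ∣ N∖F ∣ + 2 * K * length F       ≤⟨ +-monoʳ-≤ (2 * K * ∣ N∖F ∣) 2K∣F∣≤n ⟩
  2 * K * ∣ N∖F ∣ + n                      ∎)
  where
  open ≤-Reasoning
  N∖F = (not ∘ (_∈ᵇ F)) ∩ neighbours c b y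
  deg≤ : deg c b y ≤ ∣ N∖F ∣ + length F
  deg≤ = ≤-trans (∣P∣≤∣P∖F∣+∣F∣ (neighbours c b y) (_∈ᵇ F)) (+-monoʳ-≤ ∣ N∖F ∣ (∣∈ᵇ∣≤length F))
  expand : ∀ K a f → 2 * (K * (a + f)) ≡ 2 * K * a + 2 * K * f
  expand = solve-∀

∣Y∣*n≤∑neighbourhoods : ∀ {n} (c : Coloring n) K b (Y A : Fin n → Bool) →
  (∀ y → T (Y y) → n ≤ 2 * K * ∣ A ∩ neighbours c b y ∣) →
  ∣ Y ∣ * n ≤ 2 * K * ∑[ x < n ] (𝟙 (A x) * ∣ Y ∩ neighbours c b x ∣)
∣Y∣*n≤∑neighbourhoods {n} c K b Y A many = begin
  ∣ Y ∣ * n                                            ≡⟨ *-distribʳ-sum n (𝟙 ∘ Y) ⟩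
  ∑[ y < n ] (𝟙 (Y y) * n)                             ≤⟨ sum-mono-≤ (λ y → 𝟙*-monoʳ-≤ (Y y) (many y)) ⟩
  ∑[ y < n ] (𝟙 (Y y) * (2 * K * ∣ A ∩ neighbours c b y ∣))
    ≡⟨ sum-cong-≗ (λ y → x*[y*z]≡y*[x*z] (𝟙 (Y y)) (2 * K) ∣ A ∩ neighbours c b y ∣) ⟩
  ∑[ y < n ] (2 * K * (𝟙 (Y y) * ∣ A ∩ neighbours c b y ∣))
    ≡⟨ *-distribˡ-sum (2 * K) (λ y → 𝟙 (Y y) * ∣ A ∩ neighbours c b y ∣) ⟨
  2 * K * ∑[ y < n ] (𝟙 (Y y) * ∣ A ∩ neighbours c b y ∣)
    ≡⟨ cong (2 * K *_) (∑𝟙*∣∩∣-swap A Y (neighbours c b) (neighbours-sym c b)) ⟩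
  2 * K * ∑[ x < n ] (𝟙 (A x) * ∣ Y ∩ neighbours c b x ∣) ∎
  where
  open ≤-Reasoning
  x*[y*z]≡y*[x*z] : ∀ x y z → x * (y * z) ≡ y * (x * z)
  x*[y*z]≡y*[x*z] = solve-∀

popular-vertex : ∀ {n} (c : Coloring n) K b (Y : Fin n → Bool) (F : List (Fin n)) →
  0 < ∣ Y ∣ → (∀ y → T (Y y) → n ≤ K * deg c b y) → 2 * K * length F ≤ n →
  ∃[ x ] x ∉ F × ∣ Y ∣ ≤ 2 * K * ∣ Y ∩ neighbours c b x ∣
popular-vertex {n} c K b Y F ∣Y∣>0 dense 2K∣F∣≤n = x , x∉F , ∣Y∣≤
  where
  open ≤-Reasoning
  -- Vertices of F weigh nothing, so a vertex of at least average weight lies outside F.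
  weight : Fin n → ℕ
  weight x = 𝟙 (not (x ∈ᵇ F)) * ∣ Y ∩ neighbours c b x ∣
  ∣Y∣*n≤ : ∣ Y ∣ * n ≤ 2 * K * sum weight
  ∣Y∣*n≤ = ∣Y∣*n≤∑neighbourhoods c K b Y (not ∘ (_∈ᵇ F))
             (λ y y∈Y → many-neighbours-outside c K b y F (dense y y∈Y) 2K∣F∣≤n)
  n>0 : 0 < n
  n>0 = <-≤-trans ∣Y∣>0 (∣P∣≤n Y)
  ∑weight>0 : 0 < sum weight
  ∑weight>0 = 0<a≤m*b⇒0<b {m = 2 * K} (*-mono-< ∣Y∣>0 n>0) ∣Y∣*n≤
  x = proj₁ (sum≤n*term weight ∑weight>0)
  ∑weight≤ : sum weight ≤ n * weight x
  ∑weight≤ = proj₂ (sum≤n*term weight ∑weight>0)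
  x∉F : x ∉ F
  x∉F x∈F = <⇒≱ (0<a≤m*b⇒0<b {m = n} ∑weight>0 ∑weight≤) (≤-reflexive weight≡0)
    where
    weight≡0 : weight x ≡ 0
    weight≡0 rewrite dec-true (DecMembership._∈?_ _≟_ x F) x∈F = refl
  ∣Y∣≤ : ∣ Y ∣ ≤ 2 * K * ∣ Y ∩ neighbours c b x ∣
  ∣Y∣≤ = *-cancelʳ-≤ _ _ n {{>-nonZero n>0}} (begin
    ∣ Y ∣ * n                               ≤⟨ ∣Y∣*n≤ ⟩
    2 * K * sum weight                      ≤⟨ *-monoʳ-≤ (2 * K) ∑weight≤ ⟩
    2 * K * (n * weight x)                  ≤⟨ *-monoʳ-≤ (2 * K) (*-monoʳ-≤ n (*-monoˡ-≤ _ (𝟙≤1 (not (x ∈ᵇ F))))) ⟩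
    2 * K * (n * (1 * ∣ Y ∩ neighbours c b x ∣)) ≡⟨ regroup (2 * K) n ∣ Y ∩ neighbours c b x ∣ ⟩
    2 * K * ∣ Y ∩ neighbours c b x ∣ * n     ∎)
    where
    regroup : ∀ a n z → a * (n * (1 * z)) ≡ a * z * n
    regroup = solve-∀

record CommonNeighbourhood {n} (c : Coloring n) (K : ℕ) (b : Bool) (m : ℕ)
                           (Y : Fin n → Bool) (F : List (Fin n)) : Set where
  field
    centre            : Fin m → Fin n
    centre-injective  : Injective _≡_ _≡_ centre
    centre∉F          : ∀ i → centre i ∉ F
    common            : Fin n → Bool
    common⊆Y          : ∀ y → T (common y) → T (Y y)
    common-neighbours : ∀ i y → T (common y) → T (neighbours c b (centre i) y)
    ∣Y∣≤∣common∣      : ∣ Y ∣ ≤ (2 * K) ^ m * ∣ common ∣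

greedy : ∀ {n} (c : Coloring n) K b m (Y : Fin n → Bool) (F : List (Fin n)) →
  0 < ∣ Y ∣ → (∀ y → T (Y y) → n ≤ K * deg c b y) → 2 * K * (length F + m) ≤ n →
  CommonNeighbourhood c K b m Y F
greedy c K b zero Y F _ _ _ = record
  { centre            = λ ()
  ; centre-injective  = λ {}
  ; centre∉F          = λ ()
  ; common            = Y
  ; common⊆Y          = λ _ y∈Y → y∈Y
  ; common-neighbours = λ ()
  ; ∣Y∣≤∣common∣      = ≤-reflexive (sym (+-identityʳ ∣ Y ∣))
  }
greedy {n} c K b (suc m) Y F ∣Y∣>0 dense 2K[F+m]≤n = record
  { centre            = centre
  ; centre-injective  = centre-injective
  ; centre∉F          = centre∉F
  ; common            = common
  ; common⊆Y          = λ y → proj₁ ∘ T-∧-split {Y y} ∘ common⊆Y y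
  ; common-neighbours = common-neighbours
  ; ∣Y∣≤∣common∣      = ≤-trans ∣Y∣≤ (≤-trans (*-monoʳ-≤ (2 * K) ∣Y∣≤∣common∣)
                                             (≤-reflexive (sym (*-assoc (2 * K) _ _))))
  }
  where
  popular = popular-vertex c K b Y F ∣Y∣>0 dense
              (≤-trans (*-monoʳ-≤ (2 * K) (m≤m+n (length F) (suc m))) 2K[F+m]≤n)
  x = proj₁ popular
  x∉F = proj₁ (proj₂ popular)
  ∣Y∣≤ = proj₂ (proj₂ popular)
  rest = greedy c K b m (Y ∩ neighbours c b x) (x ∷ F)
           (0<a≤m*b⇒0<b {m = 2 * K} ∣Y∣>0 ∣Y∣≤) (λ y → dense y ∘ proj₁ ∘ T-∧-split {Y y})
           (≤-trans (≤-reflexive (cong (2 * K *_) (sym (+-suc (length F) m)))) 2K[F+m]≤n)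
  open CommonNeighbourhood rest using (common; common⊆Y; ∣Y∣≤∣common∣)
    renaming (centre to centre′; centre-injective to centre′-injective; centre∉F to centre′∉x∷F;
              common-neighbours to common-neighbours′)
  centre : Fin (suc m) → Fin n
  centre zero    = x
  centre (suc i) = centre′ i
  centre-injective : Injective _≡_ _≡_ centre
  centre-injective {zero}  {zero}  _   = refl
  centre-injective {zero}  {suc j} x≡  = ⊥-elim (centre′∉x∷F j (here (sym x≡)))
  centre-injective {suc i} {zero}  ≡x  = ⊥-elim (centre′∉x∷F i (here ≡x))
  centre-injective {suc i} {suc j} eq = cong suc (centre′-injective eq)
  centre∉F : ∀ i → centre i ∉ F
  centre∉F zero    = x∉F
  centre∉F (suc i) = centre′∉x∷F i ∘ there
  common-neighbours : ∀ i y → T (common y) → T (neighbours c b (centre i) y)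
  common-neighbours zero    y = proj₂ ∘ T-∧-split {Y y} ∘ common⊆Y y
  common-neighbours (suc i) y = common-neighbours′ i y

-- Assembling the copy of M_{l,k}

restrict : ∀ {n r} → Coloring n → (Fin r → Fin n) → Coloring r
restrict c f = record { col = λ i j → col c (f i) (f j) ; symm = λ i j → symm c (f i) (f j) }

ramsey-positive : ∀ {k r} → 1 ≤ k → RamseyProp k r → 1 ≤ r
ramsey-positive {suc k} {zero} _ ramsey with ramsey (record { col = λ () ; symm = λ () })
... | f , _ = ⊥-elim (¬Fin0 (f zero))
ramsey-positive {r = suc r} _ _ = s≤s z≤n

copyM : ∀ {n l k} (c : Coloring n) (X : Fin l → Fin n) (Z : Fin k → Fin n) →
  Injective _≡_ _≡_ X → Injective _≡_ _≡_ Z → (a : Bool) →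
  (∀ i j → i ≢ j → col c (Z i) (Z j) ≡ a) → (∀ u v → T (neighbours c (not a) (X u) (Z v))) → HasCopyM l k c
copyM {n} {l} {k} c X Z X-inj Z-inj a clique adjacent = φ , φ-injective , a , clique , (λ u v → proj₂ (sound u v))
  where
  sound : ∀ u v → X u ≢ Z v × col c (X u) (Z v) ≡ not a
  sound u v = neighbours-sound c (not a) (X u) (Z v) (adjacent u v)
  φ : Fin l ⊎ Fin k → Fin n
  φ (inj₁ u) = X u
  φ (inj₂ v) = Z v
  φ-injective : Injective _≡_ _≡_ φ
  φ-injective {inj₁ u} {inj₁ u′} e = cong inj₁ (X-inj e)
  φ-injective {inj₂ v} {inj₂ v′} e = cong inj₂ (Z-inj e)
  φ-injective {inj₁ u} {inj₂ v}  e = ⊥-elim (proj₁ (sound u v) e)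
  φ-injective {inj₂ v} {inj₁ u}  e = ⊥-elim (proj₁ (sound u v) (sym e))

record Hubs {n} (c : Coloring n) (l : ℕ) (core : Fin n → Bool) : Set where
  field
    hub           : Bool → Fin l → Fin n
    hub-injective : ∀ b → Injective _≡_ _≡_ (hub b)
    hub-adjacent  : ∀ b u y → T (core y) → T (neighbours c b (hub b u) y)

two-rounds : ∀ {n} (c : Coloring n) K l (D : Fin n → Bool) → 0 < ∣ D ∣ →
  (∀ y → T (D y) → ∀ b → n ≤ K * deg c b y) → 2 * K * l ≤ n →
  Σ (Fin n → Bool) λ core → Hubs c l core × ∣ D ∣ ≤ (2 * K) ^ l * (2 * K) ^ l * ∣ core ∣
two-rounds {n} c K l D ∣D∣>0 dense 2Kl≤n = core , hubs , ∣D∣≤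
  where
  open CommonNeighbourhood
  blue = greedy c K false l D [] ∣D∣>0 (λ y y∈D → dense y y∈D false) 2Kl≤n
  red  = greedy c K true l (common blue) []
           (0<a≤m*b⇒0<b {m = (2 * K) ^ l} ∣D∣>0 (∣Y∣≤∣common∣ blue))
           (λ y y∈B → dense y (common⊆Y blue y y∈B) true) 2Kl≤n
  core = common red
  hubs : Hubs c l core
  hubs = record
    { hub           = λ { false → centre blue ; true → centre red }
    ; hub-injective = λ { false → centre-injective blue ; true → centre-injective red }
    ; hub-adjacent  = λ { false u y → common-neighbours blue u y ∘ common⊆Y red y
                        ; true  u y → common-neighbours red u y }
    }
  ∣D∣≤ : ∣ D ∣ ≤ (2 * K) ^ l * (2 * K) ^ l * ∣ core ∣
  ∣D∣≤ = begin
    ∣ D ∣                                  ≤⟨ ∣Y∣≤∣common∣ blue ⟩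
    (2 * K) ^ l * ∣ common blue ∣          ≤⟨ *-monoʳ-≤ ((2 * K) ^ l) (∣Y∣≤∣common∣ red) ⟩
    (2 * K) ^ l * ((2 * K) ^ l * ∣ core ∣) ≡⟨ *-assoc ((2 * K) ^ l) _ _ ⟨
    (2 * K) ^ l * (2 * K) ^ l * ∣ core ∣   ∎
    where open ≤-Reasoning

dense⇒copyM : ∀ {n} l k r (c : Coloring n) K (D : Fin n → Bool) → RamseyProp k r → 1 ≤ r → 1 ≤ K →
  (∀ y → T (D y) → ∀ b → n ≤ K * deg c b y) → 2 * K * l ≤ n →
  K * ((2 * K) ^ l * (2 * K) ^ l) * r ≤ n → n ≤ K * ∣ D ∣ → HasCopyM l k c
dense⇒copyM {n} l k r c K D ramsey r≥1 K≥1 dense 2Kl≤n KPr≤n n≤K∣D∣ =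
  copyM c (hub (not a)) (f ∘ g) (hub-injective (not a)) (g-injective ∘ f-injective) a clique
    (λ u v → hub-adjacent (not a) u (f (g v)) (f∈core (g v)))
  where
  P = (2 * K) ^ l * (2 * K) ^ l
  KP>0 : 0 < K * P
  KP>0 = let 2K^l>0 = m^n>0 (2 * K) {{>-nonZero (≤-trans K≥1 (m≤n*m K 2))}} l
         in *-mono-≤ K≥1 (*-mono-≤ 2K^l>0 2K^l>0)
  ∣D∣>0 : 0 < ∣ D ∣
  ∣D∣>0 = 0<a≤m*b⇒0<b {m = K} (≤-trans (*-mono-≤ KP>0 r≥1) KPr≤n) n≤K∣D∣
  rounds = two-rounds c K l D ∣D∣>0 dense 2Kl≤n
  core = proj₁ rounds
  open Hubs (proj₁ (proj₂ rounds))
  r≤∣core∣ : r ≤ ∣ core ∣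
  r≤∣core∣ = *-cancelˡ-≤ (K * P) {{>-nonZero KP>0}} (begin
    K * P * r       ≤⟨ KPr≤n ⟩
    n               ≤⟨ n≤K∣D∣ ⟩
    K * ∣ D ∣        ≤⟨ *-monoʳ-≤ K (proj₂ (proj₂ rounds)) ⟩
    K * (P * ∣ core ∣) ≡⟨ *-assoc K P ∣ core ∣ ⟨
    K * P * ∣ core ∣ ∎)
    where open ≤-Reasoning
  f = proj₁ (∣∣-injection core r≤∣core∣)
  f-injective = proj₁ (proj₂ (∣∣-injection core r≤∣core∣))
  f∈core = proj₂ (proj₂ (∣∣-injection core r≤∣core∣))
  g = proj₁ (ramsey (restrict c f))
  g-injective = proj₁ (proj₂ (ramsey (restrict c f)))
  a = proj₁ (proj₂ (proj₂ (ramsey (restrict c f))))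
  clique = proj₂ (proj₂ (proj₂ (ramsey (restrict c f))))

theorem2 : (p q : ℕ) → 0 < p → 2 * p < q → (l : ℕ) →
    ∃[ C ] ((k : ℕ) → 1 ≤ k → (r : ℕ) → IsRamseyNumber k r →
      (n : ℕ) → C * r ≤ n → (c : Coloring n) → Balanced p q c → HasCopyM l k c)
theorem2 p q p>0 2p<q l = constant , λ k k≥1 r (ramsey , _) n Cr≤n c balanced →
  let r≥1 = ramsey-positive k≥1 ramsey
      constant≤n = ≤-trans (m≤m*n constant r {{>-nonZero r≥1}}) Cr≤n
  in dense⇒copyM l k r c K (mixed c K) ramsey r≥1 K≥1 (mixed⇒n≤deg c K)
       (≤-trans (m≤n+m (2 * K * l) (K * P)) (≤-trans (m≤m+n _ 8) constant≤n))
       (≤-trans (*-monoˡ-≤ r (≤-trans (m≤m+n (K * P) _) (m≤m+n _ 8))) Cr≤n)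
       (many-mixed p q c p>0 q≥1 (≤-trans (m≤n+m 8 _) constant≤n) balanced)
  where
  K = 16 * (q * q)
  P = (2 * K) ^ l * (2 * K) ^ l
  constant = K * P + 2 * K * l + 8
  q≥1 : 1 ≤ q
  q≥1 = ≤-trans (s≤s z≤n) 2p<q
  K≥1 : 1 ≤ K
  K≥1 = *-mono-≤ {1} {16} (s≤s z≤n) (*-mono-≤ q≥1 q≥1)
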